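{- Let $\mathbf d=(\mathbf a,\mathbf b)\in\mathbb Z^{N\times2}$ with $\sum_n a_n=\sum_n b_n+1$, and let $i\neq j$ be indices with $a_i\ge a_j>0$. Put $\mathbf d_{ -i}=(\mathbf a-\mathbf e_i,\mathbf b)$ and $\mathbf d_{ -j}=(\mathbf a-\mathbf e_j,\mathbf b)$. Then $$\|G_{\mathbf d_{ -i}}\|\ge\frac{a_i}{a_j}\|G_{\mathbf d_{ -j}}\|.$$
   Context: $\|G_{\mathbf d}\|$ is the number of directed graphs on $\{1,\dots,N\}$ (each ordered pair, including loops, carrying at most one edge) with in-degree sequence $\mathbf a$ and out-degree sequence $\mathbf b$; equivalently the number of $N\times N$ $0$-$1$ matrices with row sums $\mathbf a$ and column sums $\mathbf b$. $\mathbf e_k$ is the $k$-th standard unit vector. -}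

module Defs where

open import Data.Bool using (Bool; true; false; _∧_; if_then_else_)
open import Data.Nat using (ℕ; zero; suc)
open import Data.Integer using (ℤ; +_; _+_; _-_; 0ℤ; 1ℤ)
import Data.Integer.Properties as ℤP
open import Data.Fin using (Fin)
import Data.Fin.Properties as FinP
open import Data.List using (List; []; _∷_; map; concatMap; length; filter; foldr; allFin)
open import Data.Vec using (Vec; []; _∷_; lookup; transpose; count)
open import Relation.Nullary using (does)
open import Relation.Nullary.Decidable using (⌊_⌋)
open import Relation.Binary.PropositionalEquality using (_≡_)

allVecs : (n : ℕ) → List (Vec Bool n)
allVecs zero = [] ∷ []
allVecs (suc n) = concatMap (λ v → (false ∷ v) ∷ (true ∷ v) ∷ []) (allVecs n)

allMats : (m n : ℕ) → List (Vec (Vec Bool n) m)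
allMats zero n = [] ∷ []
allMats (suc m) n = concatMap (λ r → map (r ∷_) (allMats m n)) (allVecs n)

ones : {n : ℕ} → Vec Bool n → ℕ
ones v = count (λ x → x Data.Bool.≟ true) v

allB : {A : Set} → (A → Bool) → List A → Bool
allB p = foldr (λ x r → p x ∧ r) true

hasMargins : {N : ℕ} → Vec (Vec Bool N) N → (Fin N → ℤ) → (Fin N → ℤ) → Bool
hasMargins {N} M a b =
  allB (λ i → does ((+ ones (lookup M i)) ℤP.≟ a i)) (allFin N)
  ∧ allB (λ k → does ((+ ones (lookup (transpose M) k)) ℤP.≟ b k)) (allFin N)

-- ‖G_d‖ for d = (a , b): number of N×N 0-1 matrices with row sums a and
-- column sums b (0 if some degree is negative or too large).
numG : (N : ℕ) → (Fin N → ℤ) → (Fin N → ℤ) → ℕ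
numG N a b = length (filter (λ M → hasMargins M a b ≟B true) (allMats N N))
  where open Data.Bool using () renaming (_≟_ to _≟B_)

minusUnit : {N : ℕ} → (Fin N → ℤ) → Fin N → (Fin N → ℤ)
minusUnit a i k = if ⌊ k FinP.≟ i ⌋ then a k - 1ℤ else a k

sumℤ : {N : ℕ} → (Fin N → ℤ) → ℤ
sumℤ {N} a = foldr (λ i s → a i + s) 0ℤ (allFin N)

-- Switching argument. Let G₋ⱼ, G₋ᵢ be the 0-1 matrices with margins 𝐝₋ⱼ, 𝐝₋ᵢ, and call the
-- number of columns k with Mᵢₖ = Mⱼₖ = 1 the codegree of M. Exchanging the entries (i , k) and
-- (j , k) is an involution that preserves column sums and the codegree, and it matches the pairs
-- (M , k) with M ∈ G₋ⱼ, Mᵢₖ = 1, Mⱼₖ = 0 with the pairs (M′ , k) with M′ ∈ G₋ᵢ, M′ᵢₖ = 0,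
-- M′ⱼₖ = 1. Row i of M ∈ G₋ⱼ has aᵢ ones and row j of M′ ∈ G₋ᵢ has aⱼ ones, so if nₜ, n′ₜ count
-- the matrices of codegree t in G₋ⱼ, G₋ᵢ, then (aᵢ − t) nₜ = (aⱼ − t) n′ₜ. Every M ∈ G₋ⱼ has
-- codegree t < aⱼ, and there aⱼ ≤ aᵢ gives aᵢ nₜ ≤ aⱼ n′ₜ; summing over t proves the claim.

module Submission where

open import Data.Bool using (Bool; true; false; _∧_; not)
import Data.Bool as Bool
import Data.Bool.Properties as BoolP
open import Data.Fin using (Fin; zero; suc; toℕ; fromℕ<)
open import Data.Fin.Properties using (_≟_; toℕ<n; toℕ-injective; toℕ-fromℕ<)
open import Data.Fin.Permutation.Components using (transpose)
open import Data.Integer using (ℤ)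
import Data.Integer as ℤ
import Data.Integer.Properties as ℤP
open import Data.List using (List; []; _∷_; _++_; map; concatMap; filter; length; allFin)
open import Data.List.Properties using (map-tabulate)
open import Data.List.Membership.Propositional using (_∈_)
open import Data.List.Membership.Propositional.Properties using (∈-allFin)
open import Data.List.Relation.Unary.Any using (here; there)
open import Data.Nat using (ℕ; zero; suc; _+_; _*_; _∸_; _≤_; _<_; z≤n; s≤s; _<?_; >-nonZero)
import Data.Nat as ℕ
open import Data.Nat.Properties hiding (_≟_)
open import Algebra.Properties.CommutativeSemigroup +-commutativeSemigroup using (interchange)
import Algebra.Properties.CommutativeSemigroup *-commutativeSemigroup as *-CS
open import Data.Vec using (Vec; []; _∷_; lookup; replicate; _⊛_)
import Data.Vec as Vec
import Data.Vec.Properties as VecP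
open import Function using (_∘_; id; _⇔_; mk⇔; Equivalence)
import Function.Properties.Equivalence as ⇔
open import Relation.Binary.Definitions using (DecidableEquality)
open import Relation.Binary.PropositionalEquality
open import Relation.Nullary using (Dec; yes; no; does; ¬_; contradiction)
open import Relation.Nullary.Decidable using (dec-true; dec-false; does-⇔)
open import Relation.Unary using (Pred; Decidable)

open import Defs

private variable
  A B : Set
  P Q : Set

𝟙 : Bool → ℕ
𝟙 true = 1
𝟙 false = 0

⟦_⟧ : Dec P → ℕ
⟦ d ⟧ = 𝟙 (does d)

⟦⟧-yes : (d : Dec P) → P → ⟦ d ⟧ ≡ 1
⟦⟧-yes d p = cong 𝟙 (dec-true d p)

⟦⟧-no : (d : Dec P) → ¬ P → ⟦ d ⟧ ≡ 0
⟦⟧-no d ¬p = cong 𝟙 (dec-false d ¬p)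

⟦⟧-guard : (d : Dec P) {x y : ℕ} → (P → x ≡ y) → ⟦ d ⟧ * x ≡ ⟦ d ⟧ * y
⟦⟧-guard (yes p) x≡y = cong (_+ 0) (x≡y p)
⟦⟧-guard (no _)  _   = refl

⟦⟧-guard₂ : (d : Dec P) (e : Dec Q) {x y : ℕ} → (P → Q → x ≡ y) →
  ⟦ d ⟧ * ⟦ e ⟧ * x ≡ ⟦ d ⟧ * (⟦ e ⟧ * y)
⟦⟧-guard₂ d e {x} x≡y =
  trans (*-assoc ⟦ d ⟧ ⟦ e ⟧ x) (⟦⟧-guard d (λ p → ⟦⟧-guard e (x≡y p)))

𝟙-∧ : ∀ x y → 𝟙 (x ∧ y) ≡ 𝟙 x * 𝟙 y
𝟙-∧ true  y = sym (+-identityʳ (𝟙 y))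
𝟙-∧ false y = refl

𝟙-splitˡ : ∀ x y → 𝟙 x ≡ 𝟙 (x ∧ y) + 𝟙 (x ∧ not y)
𝟙-splitˡ true  true  = refl
𝟙-splitˡ true  false = refl
𝟙-splitˡ false y     = refl

𝟙-splitʳ : ∀ x y → 𝟙 y ≡ 𝟙 (x ∧ y) + 𝟙 (not x ∧ y)
𝟙-splitʳ true  y     = sym (+-identityʳ (𝟙 y))
𝟙-splitʳ false true  = refl
𝟙-splitʳ false false = refl

∑ : List A → (A → ℕ) → ℕ
∑ []       f = 0
∑ (x ∷ xs) f = f x + ∑ xs f

infix 5 ∑
syntax ∑ L (λ x → e) = ∑[ x ∈ L ] e

module _ {f g : A → ℕ} where

  ∑-cong : (L : List A) → (∀ x → f x ≡ g x) → ∑ L f ≡ ∑ L g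
  ∑-cong []      _ = refl
  ∑-cong (x ∷ L) e = cong₂ _+_ (e x) (∑-cong L e)

  ∑-mono : (L : List A) → (∀ x → f x ≤ g x) → ∑ L f ≤ ∑ L g
  ∑-mono []      _ = z≤n
  ∑-mono (x ∷ L) e = +-mono-≤ (e x) (∑-mono L e)

  ∑-+ : (L : List A) → ∑[ x ∈ L ] (f x + g x) ≡ ∑ L f + ∑ L g
  ∑-+ []      = refl
  ∑-+ (x ∷ L) = trans (cong (f x + g x +_) (∑-+ L)) (interchange (f x) (g x) (∑ L f) (∑ L g))

∑-zero : (L : List A) → ∑[ x ∈ L ] 0 ≡ 0
∑-zero []      = refl
∑-zero (x ∷ L) = ∑-zero L

∑-*ˡ : (c : ℕ) (f : A → ℕ) (L : List A) → ∑[ x ∈ L ] c * f x ≡ c * ∑ L f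
∑-*ˡ c f []      = sym (*-zeroʳ c)
∑-*ˡ c f (x ∷ L) = trans (cong (c * f x +_) (∑-*ˡ c f L)) (sym (*-distribˡ-+ c (f x) (∑ L f)))

∑-*ʳ : (c : ℕ) (f : A → ℕ) (L : List A) → ∑[ x ∈ L ] f x * c ≡ ∑ L f * c
∑-*ʳ c f L = trans (∑-cong L (λ x → *-comm (f x) c)) (trans (∑-*ˡ c f L) (*-comm c (∑ L f)))

∑-++ : (f : A → ℕ) (L K : List A) → ∑ (L ++ K) f ≡ ∑ L f + ∑ K f
∑-++ f []      K = refl
∑-++ f (x ∷ L) K = trans (cong (f x +_) (∑-++ f L K)) (sym (+-assoc (f x) (∑ L f) (∑ K f)))

∑-map : (f : B → ℕ) (g : A → B) (L : List A) → ∑ (map g L) f ≡ ∑[ x ∈ L ] f (g x)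
∑-map f g []      = refl
∑-map f g (x ∷ L) = cong (f (g x) +_) (∑-map f g L)

∑-concatMap : (f : B → ℕ) (h : A → List B) (L : List A) →
  ∑ (concatMap h L) f ≡ ∑[ x ∈ L ] ∑ (h x) f
∑-concatMap f h []      = refl
∑-concatMap f h (x ∷ L) =
  trans (∑-++ f (h x) (concatMap h L)) (cong (∑ (h x) f +_) (∑-concatMap f h L))

∑-comm : (g : A → B → ℕ) (L : List A) (K : List B) →
  ∑[ x ∈ L ] ∑[ y ∈ K ] g x y ≡ ∑[ y ∈ K ] ∑[ x ∈ L ] g x y
∑-comm g []      K = sym (∑-zero K)
∑-comm g (x ∷ L) K = trans (cong (∑ K (g x) +_) (∑-comm g L K)) (sym (∑-+ K))

length-filter : {P : Pred A _} (P? : Decidable P) (L : List A) →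
  length (filter P? L) ≡ ∑[ x ∈ L ] ⟦ P? x ⟧
length-filter P? []      = refl
length-filter P? (x ∷ L) with does (P? x)
... | true  = cong suc (length-filter P? L)
... | false = length-filter P? L

record Enumerates (_≟ᴬ_ : DecidableEquality A) (L : List A) : Set where
  constructor occurring-once
  field occurs-once : ∀ x → ∑[ y ∈ L ] ⟦ y ≟ᴬ x ⟧ ≡ 1

open Enumerates

module _ {_≟ᴬ_ : DecidableEquality A} {L : List A} (enum : Enumerates _≟ᴬ_ L) where

  ∑-select : (g : A → ℕ) (z : A) → ∑[ y ∈ L ] ⟦ y ≟ᴬ z ⟧ * g y ≡ g z
  ∑-select g z = begin
    ∑[ y ∈ L ] ⟦ y ≟ᴬ z ⟧ * g y  ≡⟨ ∑-cong L (λ y → ⟦⟧-guard (y ≟ᴬ z) (cong g)) ⟩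
    ∑[ y ∈ L ] ⟦ y ≟ᴬ z ⟧ * g z  ≡⟨ ∑-*ʳ (g z) (λ y → ⟦ y ≟ᴬ z ⟧) L ⟩
    (∑[ y ∈ L ] ⟦ y ≟ᴬ z ⟧) * g z ≡⟨ cong (_* g z) (occurs-once enum z) ⟩
    1 * g z                      ≡⟨ *-identityˡ (g z) ⟩
    g z                          ∎
    where open ≡-Reasoning

  ∑-reindex : (σ ρ : A → A) → (∀ x → ρ (σ x) ≡ x) → (∀ y → σ (ρ y) ≡ y) →
    (f : A → ℕ) → ∑[ x ∈ L ] f (σ x) ≡ ∑ L f
  ∑-reindex σ ρ ρσ σρ f = begin
    ∑[ x ∈ L ] f (σ x)
      ≡⟨ ∑-cong L (λ x → ∑-select f (σ x)) ⟨
    ∑[ x ∈ L ] (∑[ y ∈ L ] ⟦ y ≟ᴬ σ x ⟧ * f y)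
      ≡⟨ ∑-comm _ L L ⟩
    ∑[ y ∈ L ] (∑[ x ∈ L ] ⟦ y ≟ᴬ σ x ⟧ * f y)
      ≡⟨ ∑-cong L (λ y → ∑-cong L (λ x → cong (_* f y) (moved x y))) ⟩
    ∑[ y ∈ L ] (∑[ x ∈ L ] ⟦ x ≟ᴬ ρ y ⟧ * f y)
      ≡⟨ ∑-cong L (λ y → ∑-select (λ _ → f y) (ρ y)) ⟩
    ∑ L f ∎
    where
    open ≡-Reasoning
    moved : ∀ x y → ⟦ y ≟ᴬ σ x ⟧ ≡ ⟦ x ≟ᴬ ρ y ⟧
    moved x y = cong 𝟙 (does-⇔ (mk⇔ (λ y≡σx → trans (sym (ρσ x)) (cong ρ (sym y≡σx)))
                                   (λ x≡ρy → trans (sym (σρ y)) (cong σ (sym x≡ρy))))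
                               (y ≟ᴬ σ x) (x ≟ᴬ ρ y))

∑-allFin-suc : {n : ℕ} (f : Fin (suc n) → ℕ) →
  ∑ (allFin (suc n)) f ≡ f zero + (∑[ k ∈ allFin n ] f (suc k))
∑-allFin-suc {n} f =
  cong (f zero +_) (trans (cong (λ L → ∑ L f) (sym (map-tabulate id suc))) (∑-map f suc (allFin n)))

allFin-enumerates : ∀ n → Enumerates _≟_ (allFin n)
allFin-enumerates n = occurring-once (occurs n)
  where
  occurs : ∀ n x → ∑[ y ∈ allFin n ] ⟦ y ≟ x ⟧ ≡ 1
  occurs (suc n) zero    =
    trans (∑-allFin-suc {n} (λ k → ⟦ k ≟ zero ⟧)) (cong suc (∑-zero (allFin n)))
  occurs (suc n) (suc x) =
    trans (∑-allFin-suc {n} (λ k → ⟦ k ≟ suc x ⟧)) (occurs n x)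

∑-indicator-toℕ : (K v : ℕ) → v < K → ∑[ t ∈ allFin K ] ⟦ v ℕ.≟ toℕ t ⟧ ≡ 1
∑-indicator-toℕ K v v<K = trans
  (∑-cong (allFin K) (λ t → cong 𝟙 (does-⇔ (equiv t) (v ℕ.≟ toℕ t) (t ≟ fromℕ< v<K))))
  (occurs-once (allFin-enumerates K) (fromℕ< v<K))
  where
  equiv : (t : Fin K) → (v ≡ toℕ t) ⇔ (t ≡ fromℕ< v<K)
  equiv t = mk⇔ (λ v≡t → toℕ-injective (trans (sym v≡t) (sym (toℕ-fromℕ< v<K))))
                (λ t≡v → trans (sym (toℕ-fromℕ< v<K)) (cong toℕ (sym t≡v)))

∑-indicator-toℕ-≤ : (K v : ℕ) → ∑[ t ∈ allFin K ] ⟦ v ℕ.≟ toℕ t ⟧ ≤ 1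
∑-indicator-toℕ-≤ K v with v <? K
... | yes v<K = ≤-reflexive (∑-indicator-toℕ K v v<K)
... | no  v≮K = ≤-trans (≤-reflexive (trans (∑-cong (allFin K) outside) (∑-zero (allFin K)))) z≤n
  where
  outside : (t : Fin K) → ⟦ v ℕ.≟ toℕ t ⟧ ≡ 0
  outside t = ⟦⟧-no (v ℕ.≟ toℕ t) (λ v≡t → v≮K (subst (_< K) (sym v≡t) (toℕ<n t)))

module _ (K : ℕ) (s : A → ℕ) (L : List A) where

  ∑-strata : (f : A → ℕ) →
    ∑[ t ∈ allFin K ] (∑[ x ∈ L ] ⟦ s x ℕ.≟ toℕ t ⟧ * f x)
      ≡ ∑[ x ∈ L ] (∑[ t ∈ allFin K ] ⟦ s x ℕ.≟ toℕ t ⟧) * f x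
  ∑-strata f = trans (∑-comm _ (allFin K) L)
    (∑-cong L (λ x → ∑-*ʳ (f x) (λ t → ⟦ s x ℕ.≟ toℕ t ⟧) (allFin K)))

  ∑-strata-≤ : (f : A → ℕ) → ∑[ t ∈ allFin K ] (∑[ x ∈ L ] ⟦ s x ℕ.≟ toℕ t ⟧ * f x) ≤ ∑ L f
  ∑-strata-≤ f = ≤-trans (≤-reflexive (∑-strata f))
    (∑-mono L (λ x → ≤-trans (*-monoˡ-≤ (f x) (∑-indicator-toℕ-≤ K (s x)))
                             (≤-reflexive (*-identityˡ (f x)))))

  ∑-stratify : {P : Pred A _} (P? : Decidable P) → (∀ x → P x → s x < K) →
    ∑[ x ∈ L ] ⟦ P? x ⟧ ≡ ∑[ t ∈ allFin K ] (∑[ x ∈ L ] ⟦ s x ℕ.≟ toℕ t ⟧ * ⟦ P? x ⟧)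
  ∑-stratify P? bounded = sym (trans (∑-strata (λ x → ⟦ P? x ⟧)) (∑-cong L counted))
    where
    counted : ∀ x → (∑[ t ∈ allFin K ] ⟦ s x ℕ.≟ toℕ t ⟧) * ⟦ P? x ⟧ ≡ ⟦ P? x ⟧
    counted x = trans (*-comm _ ⟦ P? x ⟧)
      (trans (⟦⟧-guard (P? x) (λ px → ∑-indicator-toℕ K (s x) (bounded x px))) (*-identityʳ ⟦ P? x ⟧))

_≟ᵛ_ : {n : ℕ} → DecidableEquality (Vec Bool n)
_≟ᵛ_ = VecP.≡-dec Bool._≟_

_≟ᴹ_ : {m n : ℕ} → DecidableEquality (Vec (Vec Bool n) m)
_≟ᴹ_ = VecP.≡-dec _≟ᵛ_

module _ {_≟ᴬ_ : DecidableEquality A} {n : ℕ} where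

  ⟦∷≟∷⟧ : (x y : A) (xs ys : Vec A n) →
    ⟦ VecP.≡-dec _≟ᴬ_ (x ∷ xs) (y ∷ ys) ⟧ ≡ ⟦ x ≟ᴬ y ⟧ * ⟦ VecP.≡-dec _≟ᴬ_ xs ys ⟧
  ⟦∷≟∷⟧ x y xs ys = 𝟙-∧ (does (x ≟ᴬ y)) (does (VecP.≡-dec _≟ᴬ_ xs ys))

  occurs-once-∷ : {L : List A} {K : List (Vec A n)} →
    Enumerates _≟ᴬ_ L → Enumerates (VecP.≡-dec _≟ᴬ_) K → (y : A) (ys : Vec A n) →
    ∑[ x ∈ L ] (∑[ xs ∈ K ] ⟦ VecP.≡-dec _≟ᴬ_ (x ∷ xs) (y ∷ ys) ⟧) ≡ 1
  occurs-once-∷ {L} {K} enumL enumK y ys = begin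
    ∑[ x ∈ L ] (∑[ xs ∈ K ] ⟦ VecP.≡-dec _≟ᴬ_ (x ∷ xs) (y ∷ ys) ⟧)
      ≡⟨ ∑-cong L (λ x → trans (∑-cong K (λ xs → ⟦∷≟∷⟧ x y xs ys)) (∑-*ˡ ⟦ x ≟ᴬ y ⟧ _ K)) ⟩
    ∑[ x ∈ L ] ⟦ x ≟ᴬ y ⟧ * (∑[ xs ∈ K ] ⟦ VecP.≡-dec _≟ᴬ_ xs ys ⟧)
      ≡⟨ ∑-cong L (λ x → cong (⟦ x ≟ᴬ y ⟧ *_) (occurs-once enumK ys)) ⟩
    ∑[ x ∈ L ] ⟦ x ≟ᴬ y ⟧ * 1
      ≡⟨ ∑-select enumL (λ _ → 1) y ⟩
    1 ∎
    where open ≡-Reasoning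

Bool-enumerates : Enumerates Bool._≟_ (false ∷ true ∷ [])
Bool-enumerates = occurring-once λ { false → refl ; true → refl }

allVecs-enumerates : ∀ n → Enumerates _≟ᵛ_ (allVecs n)
allVecs-enumerates zero    = occurring-once λ { [] → refl }
allVecs-enumerates (suc n) = occurring-once λ { (y ∷ ys) → occurs y ys }
  where
  occurs : ∀ y ys → ∑[ v ∈ allVecs (suc n) ] ⟦ v ≟ᵛ (y ∷ ys) ⟧ ≡ 1
  occurs y ys = begin
    ∑[ v ∈ allVecs (suc n) ] ⟦ v ≟ᵛ (y ∷ ys) ⟧
      ≡⟨ ∑-concatMap _ (λ v → (false ∷ v) ∷ (true ∷ v) ∷ []) (allVecs n) ⟩
    ∑[ v ∈ allVecs n ] (∑[ x ∈ false ∷ true ∷ [] ] ⟦ (x ∷ v) ≟ᵛ (y ∷ ys) ⟧)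
      ≡⟨ ∑-comm (λ v x → ⟦ (x ∷ v) ≟ᵛ (y ∷ ys) ⟧) (allVecs n) (false ∷ true ∷ []) ⟩
    ∑[ x ∈ false ∷ true ∷ [] ] (∑[ v ∈ allVecs n ] ⟦ (x ∷ v) ≟ᵛ (y ∷ ys) ⟧)
      ≡⟨ occurs-once-∷ Bool-enumerates (allVecs-enumerates n) y ys ⟩
    1 ∎
    where open ≡-Reasoning

allMats-enumerates : ∀ m n → Enumerates _≟ᴹ_ (allMats m n)
allMats-enumerates zero    n = occurring-once λ { [] → refl }
allMats-enumerates (suc m) n = occurring-once λ { (r ∷ rs) → occurs r rs }
  where
  occurs : ∀ r rs → ∑[ M ∈ allMats (suc m) n ] ⟦ M ≟ᴹ (r ∷ rs) ⟧ ≡ 1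
  occurs r rs = begin
    ∑[ M ∈ allMats (suc m) n ] ⟦ M ≟ᴹ (r ∷ rs) ⟧
      ≡⟨ ∑-concatMap _ (λ v → map (v ∷_) (allMats m n)) (allVecs n) ⟩
    ∑[ v ∈ allVecs n ] ∑ (map (v ∷_) (allMats m n)) (λ M → ⟦ M ≟ᴹ (r ∷ rs) ⟧)
      ≡⟨ ∑-cong (allVecs n) (λ v → ∑-map _ (v ∷_) (allMats m n)) ⟩
    ∑[ v ∈ allVecs n ] (∑[ M ∈ allMats m n ] ⟦ (v ∷ M) ≟ᴹ (r ∷ rs) ⟧)
      ≡⟨ occurs-once-∷ (allVecs-enumerates n) (allMats-enumerates m n) r rs ⟩
    1 ∎
    where open ≡-Reasoning

module _ {n : ℕ} {i j : Fin n} where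

  transpose-at-i : transpose i j i ≡ j
  transpose-at-i with i ≟ i
  ... | yes _  = refl
  ... | no i≢i = contradiction refl i≢i

  transpose-at-j : transpose i j j ≡ i
  transpose-at-j with j ≟ i
  ... | yes j≡i = j≡i
  ... | no _ with j ≟ j
  ...   | yes _  = refl
  ...   | no j≢j = contradiction refl j≢j

  transpose-fixes : {r : Fin n} → r ≢ i → r ≢ j → transpose i j r ≡ r
  transpose-fixes {r} r≢i r≢j with r ≟ i
  ... | yes r≡i = contradiction r≡i r≢i
  ... | no _ with r ≟ j
  ...   | yes r≡j = contradiction r≡j r≢j
  ...   | no _    = refl

  transpose-involutive : (r : Fin n) → transpose i j (transpose i j r) ≡ r
  transpose-involutive r = by-cases (r ≟ i) (r ≟ j)
    where
    by-cases : Dec (r ≡ i) → Dec (r ≡ j) → transpose i j (transpose i j r) ≡ r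
    by-cases (yes r≡i) _ = subst (λ r → transpose i j (transpose i j r) ≡ r) (sym r≡i)
      (trans (cong (transpose i j) transpose-at-i) transpose-at-j)
    by-cases (no _) (yes r≡j) = subst (λ r → transpose i j (transpose i j r) ≡ r) (sym r≡j)
      (trans (cong (transpose i j) transpose-at-j) transpose-at-i)
    by-cases (no r≢i) (no r≢j) =
      trans (cong (transpose i j) (transpose-fixes r≢i r≢j)) (transpose-fixes r≢i r≢j)

ones-∑ : {n : ℕ} (v : Vec Bool n) → ones v ≡ ∑[ k ∈ allFin n ] 𝟙 (lookup v k)
ones-∑ []           = refl
ones-∑ (true  ∷ v) = trans (cong suc (ones-∑ v)) (sym (∑-allFin-suc (λ k → 𝟙 (lookup (true ∷ v) k))))
ones-∑ (false ∷ v) = trans (ones-∑ v) (sym (∑-allFin-suc (λ k → 𝟙 (lookup (false ∷ v) k))))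

lookup-transpose : {m n : ℕ} (M : Vec (Vec A n) m) (k : Fin n) (r : Fin m) →
  lookup (lookup (Vec.transpose M) k) r ≡ lookup (lookup M r) k
lookup-transpose {m = suc m} {n} (v ∷ M) k r = begin
  lookup (lookup (replicate n cons ⊛ v ⊛ Vec.transpose M) k) r
    ≡⟨ cong (λ w → lookup w r) (VecP.lookup-⊛ k (replicate n cons ⊛ v) (Vec.transpose M)) ⟩
  lookup (lookup (replicate n cons ⊛ v) k (lookup (Vec.transpose M) k)) r
    ≡⟨ cong (λ f → lookup (f (lookup (Vec.transpose M) k)) r) (VecP.lookup-⊛ k (replicate n cons) v) ⟩
  lookup (lookup (replicate n cons) k (lookup v k) (lookup (Vec.transpose M) k)) r
    ≡⟨ cong (λ f → lookup (f (lookup v k) (lookup (Vec.transpose M) k)) r) (VecP.lookup-replicate k cons) ⟩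
  lookup (lookup v k ∷ lookup (Vec.transpose M) k) r
    ≡⟨ row r ⟩
  lookup (lookup (v ∷ M) r) k ∎
  where
  open ≡-Reasoning
  cons : A → Vec A m → Vec A (suc m)
  cons = _∷_
  row : ∀ r → lookup (lookup v k ∷ lookup (Vec.transpose M) k) r ≡ lookup (lookup (v ∷ M) r) k
  row zero    = refl
  row (suc r) = lookup-transpose M k r

Matrix : ℕ → Set
Matrix N = Vec (Vec Bool N) N

module _ {N : ℕ} where

  entry : Matrix N → Fin N → Fin N → Bool
  entry M r k = lookup (lookup M r) k

  tabulateᴹ : (Fin N → Fin N → Bool) → Matrix N
  tabulateᴹ f = Vec.tabulate (λ r → Vec.tabulate (f r))

  entry-tabulateᴹ : (f : Fin N → Fin N → Bool) (r k : Fin N) → entry (tabulateᴹ f) r k ≡ f r k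
  entry-tabulateᴹ f r k =
    trans (cong (λ v → lookup v k) (VecP.lookup∘tabulate _ r)) (VecP.lookup∘tabulate (f r) k)

  tabulateᴹ-entry : (M : Matrix N) → tabulateᴹ (entry M) ≡ M
  tabulateᴹ-entry M =
    trans (VecP.tabulate-cong (λ r → VecP.tabulate∘lookup (lookup M r))) (VecP.tabulate∘lookup M)

  matrix-ext : {M M′ : Matrix N} → (∀ r k → entry M r k ≡ entry M′ r k) → M ≡ M′
  matrix-ext {M} {M′} same = begin
    M                  ≡⟨ tabulateᴹ-entry M ⟨
    tabulateᴹ (entry M)  ≡⟨ VecP.tabulate-cong (λ r → VecP.tabulate-cong (same r)) ⟩
    tabulateᴹ (entry M′) ≡⟨ tabulateᴹ-entry M′ ⟩
    M′                 ∎
    where open ≡-Reasoning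

  rowSum colSum : Matrix N → Fin N → ℕ
  rowSum M r = ones (lookup M r)
  colSum M k = ones (lookup (Vec.transpose M) k)

  rowSum-∑ : (M : Matrix N) (r : Fin N) → rowSum M r ≡ ∑[ k ∈ allFin N ] 𝟙 (entry M r k)
  rowSum-∑ M r = ones-∑ (lookup M r)

  colSum-∑ : (M : Matrix N) (k : Fin N) → colSum M k ≡ ∑[ r ∈ allFin N ] 𝟙 (entry M r k)
  colSum-∑ M k = trans (ones-∑ (lookup (Vec.transpose M) k))
    (∑-cong (allFin N) (λ r → cong 𝟙 (lookup-transpose M k r)))

-- Opened only from here on: the prefix operator +_ of ℤ makes ℕ-sections like (x +_) ambiguous.
open import Data.Integer using (+_; -1ℤ; 1ℤ; 0ℤ; ∣_∣; +≤+)

does-true : (d : Dec P) → does d ≡ true → P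
does-true (yes p) _ = p

∧-true-left : ∀ {x y} → x ∧ y ≡ true → x ≡ true
∧-true-left {true} _ = refl

allB-cong : {p q : A → Bool} (L : List A) → (∀ x → p x ≡ q x) → allB p L ≡ allB q L
allB-cong []      _    = refl
allB-cong (x ∷ L) p≗q = cong₂ _∧_ (p≗q x) (allB-cong L p≗q)

allB-true : {p : A → Bool} {L : List A} → allB p L ≡ true → ∀ {x} → x ∈ L → p x ≡ true
allB-true {p = p} {L = y ∷ L} all x∈ with p y in py
allB-true {L = y ∷ L} all (here refl)  | true = py
allB-true {L = y ∷ L} all (there x∈L) | true = allB-true all x∈L

minusUnit-⇔ : {N : ℕ} (a : Fin N → ℤ) (c r : Fin N) (x : ℤ) →
  (x ≡ minusUnit a c r) ⇔ (x ℤ.+ + ⟦ r ≟ c ⟧ ≡ a r)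
minusUnit-⇔ a c r x with r ≟ c
... | yes _ = mk⇔
  (λ x≡ar-1 → trans (cong (ℤ._+ + 1) x≡ar-1)
                    (trans (ℤP.+-assoc (a r) -1ℤ (+ 1)) (ℤP.+-identityʳ (a r))))
  (λ x+1≡ar → trans (sym (ℤP.+-identityʳ x))
                    (trans (sym (ℤP.+-assoc x (+ 1) -1ℤ)) (cong (ℤ._- 1ℤ) x+1≡ar)))
... | no _ = mk⇔ (trans (ℤP.+-identityʳ x)) (trans (sym (ℤP.+-identityʳ x)))

module _ {N : ℕ} where

  hasMargins⇒rowSum : {M : Matrix N} {a b : Fin N → ℤ} → hasMargins M a b ≡ true →
    ∀ r → + rowSum M r ≡ a r
  hasMargins⇒rowSum {M} {a} h r =
    does-true (+ rowSum M r ℤP.≟ a r) (allB-true (∧-true-left h) (∈-allFin r))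

  hasMargins-minusUnit⇒rowSum : {M : Matrix N} {a b : Fin N → ℤ} {c : Fin N} →
    hasMargins M (minusUnit a c) b ≡ true → ∀ r → + (rowSum M r + ⟦ r ≟ c ⟧) ≡ a r
  hasMargins-minusUnit⇒rowSum {M} {a} {b} {c} h r =
    Equivalence.to (minusUnit-⇔ a c r (+ rowSum M r)) (hasMargins⇒rowSum {M} {minusUnit a c} {b} h r)

  hasMargins-cong : {M M′ : Matrix N} {a a′ b : Fin N → ℤ} →
    (∀ r → (+ rowSum M r ≡ a r) ⇔ (+ rowSum M′ r ≡ a′ r)) → (∀ k → colSum M k ≡ colSum M′ k) →
    hasMargins M a b ≡ hasMargins M′ a′ b
  hasMargins-cong {M} {M′} {a} {a′} {b} rows cols = cong₂ _∧_
    (allB-cong (allFin N) (λ r → does-⇔ (rows r) (+ rowSum M r ℤP.≟ a r) (+ rowSum M′ r ℤP.≟ a′ r)))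
    (allB-cong (allFin N) (λ k → cong (λ s → does (+ s ℤP.≟ b k)) (cols k)))

module Switching {N : ℕ} (i j : Fin N) (i≢j : i ≢ j) where

  swapRowsAt : Fin N → Fin N → Fin N → Fin N
  swapRowsAt c k with k ≟ c
  ... | yes _ = transpose i j
  ... | no  _ = id

  swapRowsAt-on : (c r : Fin N) → swapRowsAt c c r ≡ transpose i j r
  swapRowsAt-on c r with c ≟ c
  ... | yes _  = refl
  ... | no c≢c = contradiction refl c≢c

  swapRowsAt-off : {c k : Fin N} → k ≢ c → (r : Fin N) → swapRowsAt c k r ≡ r
  swapRowsAt-off {c} {k} k≢c r with k ≟ c
  ... | yes k≡c = contradiction k≡c k≢c
  ... | no  _   = refl

  swapRowsAt-involutive : (c k r : Fin N) → swapRowsAt c k (swapRowsAt c k r) ≡ r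
  swapRowsAt-involutive c k r with k ≟ c
  ... | yes _ = transpose-involutive r
  ... | no  _ = refl

  switch : Fin N → Matrix N → Matrix N
  switch c M = tabulateᴹ (λ r k → entry M (swapRowsAt c k r) k)

  entry-switch : (c : Fin N) (M : Matrix N) (r k : Fin N) →
    entry (switch c M) r k ≡ entry M (swapRowsAt c k r) k
  entry-switch c M = entry-tabulateᴹ (λ r k → entry M (swapRowsAt c k r) k)

  entry-switch-on : (c : Fin N) (M : Matrix N) (r : Fin N) →
    entry (switch c M) r c ≡ entry M (transpose i j r) c
  entry-switch-on c M r = trans (entry-switch c M r c) (cong (λ r′ → entry M r′ c) (swapRowsAt-on c r))

  entry-switch-off : {c k : Fin N} (M : Matrix N) (r : Fin N) → k ≢ c →
    entry (switch c M) r k ≡ entry M r k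
  entry-switch-off {c} {k} M r k≢c =
    trans (entry-switch c M r k) (cong (λ r′ → entry M r′ k) (swapRowsAt-off k≢c r))

  switch-involutive : (c : Fin N) (M : Matrix N) → switch c (switch c M) ≡ M
  switch-involutive c M = matrix-ext λ r k → begin
    entry (switch c (switch c M)) r k
      ≡⟨ entry-switch c (switch c M) r k ⟩
    entry (switch c M) (swapRowsAt c k r) k
      ≡⟨ entry-switch c M (swapRowsAt c k r) k ⟩
    entry M (swapRowsAt c k (swapRowsAt c k r)) k
      ≡⟨ cong (λ r′ → entry M r′ k) (swapRowsAt-involutive c k r) ⟩
    entry M r k ∎
    where open ≡-Reasoning

  colSum-switch : (c : Fin N) (M : Matrix N) (k : Fin N) → colSum (switch c M) k ≡ colSum M k
  colSum-switch c M k = begin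
    colSum (switch c M) k
      ≡⟨ colSum-∑ (switch c M) k ⟩
    ∑[ r ∈ allFin N ] 𝟙 (entry (switch c M) r k)
      ≡⟨ ∑-cong (allFin N) (λ r → cong 𝟙 (entry-switch c M r k)) ⟩
    ∑[ r ∈ allFin N ] 𝟙 (entry M (swapRowsAt c k r) k)
      ≡⟨ ∑-reindex (allFin-enumerates N) (swapRowsAt c k) (swapRowsAt c k)
                   (swapRowsAt-involutive c k) (swapRowsAt-involutive c k) (λ r → 𝟙 (entry M r k)) ⟩
    ∑[ r ∈ allFin N ] 𝟙 (entry M r k)
      ≡⟨ colSum-∑ M k ⟨
    colSum M k ∎
    where open ≡-Reasoning

  codegree : Matrix N → ℕ
  codegree M = ∑[ k ∈ allFin N ] 𝟙 (entry M i k ∧ entry M j k)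

  codegree-switch : (c : Fin N) (M : Matrix N) → codegree (switch c M) ≡ codegree M
  codegree-switch c M = ∑-cong (allFin N) column
    where
    column : ∀ k → 𝟙 (entry (switch c M) i k ∧ entry (switch c M) j k) ≡ 𝟙 (entry M i k ∧ entry M j k)
    column k with k ≟ c
    ... | yes refl rewrite entry-switch-on k M i | entry-switch-on k M j
                         | transpose-at-i {i = i} {j} | transpose-at-j {i = i} {j} =
      cong 𝟙 (BoolP.∧-comm (entry M j k) (entry M i k))
    ... | no k≢c rewrite entry-switch-off M i k≢c | entry-switch-off M j k≢c = refl

  module _ {c : Fin N} {M : Matrix N} (Mic : entry M i c ≡ true) (Mjc : entry M j c ≡ false) where

    rowSum-switch : (r : Fin N) → rowSum (switch c M) r + ⟦ r ≟ i ⟧ ≡ rowSum M r + ⟦ r ≟ j ⟧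
    rowSum-switch r = begin
      rowSum (switch c M) r + ⟦ r ≟ i ⟧
        ≡⟨ cong₂ _+_ (rowSum-∑ (switch c M) r)
                     (sym (∑-select (allFin-enumerates N) (λ _ → ⟦ r ≟ i ⟧) c)) ⟩
      (∑[ k ∈ allFin N ] 𝟙 (entry (switch c M) r k)) + (∑[ k ∈ allFin N ] ⟦ k ≟ c ⟧ * ⟦ r ≟ i ⟧)
        ≡⟨ ∑-+ (allFin N) ⟨
      ∑[ k ∈ allFin N ] (𝟙 (entry (switch c M) r k) + ⟦ k ≟ c ⟧ * ⟦ r ≟ i ⟧)
        ≡⟨ ∑-cong (allFin N) column ⟩
      ∑[ k ∈ allFin N ] (𝟙 (entry M r k) + ⟦ k ≟ c ⟧ * ⟦ r ≟ j ⟧)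
        ≡⟨ ∑-+ (allFin N) ⟩
      (∑[ k ∈ allFin N ] 𝟙 (entry M r k)) + (∑[ k ∈ allFin N ] ⟦ k ≟ c ⟧ * ⟦ r ≟ j ⟧)
        ≡⟨ cong₂ _+_ (sym (rowSum-∑ M r)) (∑-select (allFin-enumerates N) (λ _ → ⟦ r ≟ j ⟧) c) ⟩
      rowSum M r + ⟦ r ≟ j ⟧ ∎
      where
      open ≡-Reasoning
      at-c : Dec (r ≡ i) → Dec (r ≡ j) →
        𝟙 (entry M (transpose i j r) c) + ⟦ r ≟ i ⟧ ≡ 𝟙 (entry M r c) + ⟦ r ≟ j ⟧
      at-c (yes refl) _
        rewrite transpose-at-i {i = i} {j} | Mic | Mjc | ⟦⟧-yes (i ≟ i) refl | ⟦⟧-no (i ≟ j) i≢j = refl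
      at-c (no r≢i) (yes refl)
        rewrite transpose-at-j {i = i} {j} | Mic | Mjc | ⟦⟧-no (j ≟ i) r≢i | ⟦⟧-yes (j ≟ j) refl = refl
      at-c (no r≢i) (no r≢j)
        rewrite transpose-fixes r≢i r≢j | ⟦⟧-no (r ≟ i) r≢i | ⟦⟧-no (r ≟ j) r≢j = refl

      column : ∀ k → 𝟙 (entry (switch c M) r k) + ⟦ k ≟ c ⟧ * ⟦ r ≟ i ⟧
                   ≡ 𝟙 (entry M r k) + ⟦ k ≟ c ⟧ * ⟦ r ≟ j ⟧
      column k with k ≟ c
      ... | yes refl rewrite entry-switch-on k M r | *-identityˡ ⟦ r ≟ i ⟧ | *-identityˡ ⟦ r ≟ j ⟧ =
        at-c (r ≟ i) (r ≟ j)
      ... | no k≢c rewrite entry-switch-off M r k≢c = refl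

    hasMargins-switch : (a b : Fin N → ℤ) →
      hasMargins M (minusUnit a j) b ≡ hasMargins (switch c M) (minusUnit a i) b
    hasMargins-switch a b =
      hasMargins-cong {M = M} {switch c M} {b = b} rows (λ k → sym (colSum-switch c M k))
      where
      rows : ∀ r → (+ rowSum M r ≡ minusUnit a j r) ⇔ (+ rowSum (switch c M) r ≡ minusUnit a i r)
      rows r = ⇔.trans (minusUnit-⇔ a j r _)
        (⇔.trans (mk⇔ (trans moved) (trans (sym moved))) (⇔.sym (minusUnit-⇔ a i r _)))
        where
        moved : + (rowSum (switch c M) r + ⟦ r ≟ i ⟧) ≡ + (rowSum M r + ⟦ r ≟ j ⟧)
        moved = cong +_ (rowSum-switch r)

balance⇒≤ : {n n′ a b t : ℕ} → n * (a ∸ t) ≡ n′ * (b ∸ t) → t < b → b ≤ a → n * a ≤ n′ * b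
balance⇒≤ {n} {n′} {a} {b} {t} balance t<b b≤a =
  *-cancelʳ-≤ (n * a) (n′ * b) (b ∸ t) {{>-nonZero (m<n⇒0<n∸m t<b)}} (begin
    n * a * (b ∸ t)     ≡⟨ *-assoc n a (b ∸ t) ⟩
    n * (a * (b ∸ t))   ≤⟨ *-monoʳ-≤ n cross ⟩
    n * (b * (a ∸ t))   ≡⟨ *-CS.x∙yz≈y∙xz n b (a ∸ t) ⟩
    b * (n * (a ∸ t))   ≡⟨ cong (b *_) balance ⟩
    b * (n′ * (b ∸ t))  ≡⟨ *-CS.x∙yz≈yx∙z b n′ (b ∸ t) ⟩
    n′ * b * (b ∸ t)    ∎)
  where
  open ≤-Reasoning
  cross : a * (b ∸ t) ≤ b * (a ∸ t)
  cross = begin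
    a * (b ∸ t)    ≡⟨ *-distribˡ-∸ a b t ⟩
    a * b ∸ a * t  ≤⟨ ∸-monoʳ-≤ (a * b) (*-monoˡ-≤ t b≤a) ⟩
    a * b ∸ b * t  ≡⟨ cong (_∸ b * t) (*-comm a b) ⟩
    b * a ∸ b * t  ≡⟨ *-distribˡ-∸ b a t ⟨
    b * (a ∸ t)    ∎

module Counting {N : ℕ} (a b : Fin N → ℤ) (i j : Fin N) (i≢j : i ≢ j)
                (aᵢ aⱼ : ℕ) (a-i : a i ≡ + aᵢ) (a-j : a j ≡ + aⱼ) where

  open Switching i j i≢j

  Ms : List (Matrix N)
  Ms = allMats N N

  ∈G₋ⱼ? : (M : Matrix N) → Dec (hasMargins M (minusUnit a j) b ≡ true)
  ∈G₋ⱼ? M = hasMargins M (minusUnit a j) b Bool.≟ true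

  ∈G₋ᵢ? : (M : Matrix N) → Dec (hasMargins M (minusUnit a i) b ≡ true)
  ∈G₋ᵢ? M = hasMargins M (minusUnit a i) b Bool.≟ true

  onlyᵢ onlyⱼ : Matrix N → ℕ
  onlyᵢ M = ∑[ k ∈ allFin N ] 𝟙 (entry M i k ∧ not (entry M j k))
  onlyⱼ M = ∑[ k ∈ allFin N ] 𝟙 (not (entry M i k) ∧ entry M j k)

  rowSum-i-split : (M : Matrix N) → rowSum M i ≡ codegree M + onlyᵢ M
  rowSum-i-split M = trans (rowSum-∑ M i)
    (trans (∑-cong (allFin N) (λ k → 𝟙-splitˡ (entry M i k) (entry M j k))) (∑-+ (allFin N)))

  rowSum-j-split : (M : Matrix N) → rowSum M j ≡ codegree M + onlyⱼ M
  rowSum-j-split M = trans (rowSum-∑ M j)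
    (trans (∑-cong (allFin N) (λ k → 𝟙-splitʳ (entry M i k) (entry M j k))) (∑-+ (allFin N)))

  module _ {M : Matrix N} (M∈G₋ⱼ : hasMargins M (minusUnit a j) b ≡ true) where

    rowSum-i-in-G₋ⱼ : rowSum M i ≡ aᵢ
    rowSum-i-in-G₋ⱼ = ℤP.+-injective (begin
      + rowSum M i                 ≡⟨ cong +_ (+-identityʳ (rowSum M i)) ⟨
      + (rowSum M i + 0)           ≡⟨ cong (λ e → + (rowSum M i + e)) (⟦⟧-no (i ≟ j) i≢j) ⟨
      + (rowSum M i + ⟦ i ≟ j ⟧)  ≡⟨ hasMargins-minusUnit⇒rowSum {M = M} {a} {b} {j} M∈G₋ⱼ i ⟩
      a i                          ≡⟨ a-i ⟩
      + aᵢ                         ∎)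
      where open ≡-Reasoning

    rowSum-j-in-G₋ⱼ : suc (rowSum M j) ≡ aⱼ
    rowSum-j-in-G₋ⱼ = ℤP.+-injective (begin
      + suc (rowSum M j)           ≡⟨ cong +_ (+-comm 1 (rowSum M j)) ⟩
      + (rowSum M j + 1)           ≡⟨ cong (λ e → + (rowSum M j + e)) (⟦⟧-yes (j ≟ j) refl) ⟨
      + (rowSum M j + ⟦ j ≟ j ⟧)  ≡⟨ hasMargins-minusUnit⇒rowSum {M = M} {a} {b} {j} M∈G₋ⱼ j ⟩
      a j                          ≡⟨ a-j ⟩
      + aⱼ                         ∎)
      where open ≡-Reasoning

    onlyᵢ-in-G₋ⱼ : onlyᵢ M ≡ aᵢ ∸ codegree M
    onlyᵢ-in-G₋ⱼ = trans (sym (m+n∸m≡n (codegree M) (onlyᵢ M)))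
      (cong (_∸ codegree M) (trans (sym (rowSum-i-split M)) rowSum-i-in-G₋ⱼ))

    codegree-in-G₋ⱼ : codegree M < aⱼ
    codegree-in-G₋ⱼ = subst (suc (codegree M) ≤_) rowSum-j-in-G₋ⱼ
      (s≤s (subst (codegree M ≤_) (sym (rowSum-j-split M)) (m≤m+n (codegree M) (onlyⱼ M))))

  module _ {M : Matrix N} (M∈G₋ᵢ : hasMargins M (minusUnit a i) b ≡ true) where

    rowSum-j-in-G₋ᵢ : rowSum M j ≡ aⱼ
    rowSum-j-in-G₋ᵢ = ℤP.+-injective (begin
      + rowSum M j                 ≡⟨ cong +_ (+-identityʳ (rowSum M j)) ⟨
      + (rowSum M j + 0)           ≡⟨ cong (λ e → + (rowSum M j + e)) (⟦⟧-no (j ≟ i) (i≢j ∘ sym)) ⟨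
      + (rowSum M j + ⟦ j ≟ i ⟧)  ≡⟨ hasMargins-minusUnit⇒rowSum {M = M} {a} {b} {i} M∈G₋ᵢ j ⟩
      a j                          ≡⟨ a-j ⟩
      + aⱼ                         ∎)
      where open ≡-Reasoning

    onlyⱼ-in-G₋ᵢ : onlyⱼ M ≡ aⱼ ∸ codegree M
    onlyⱼ-in-G₋ᵢ = trans (sym (m+n∸m≡n (codegree M) (onlyⱼ M)))
      (cong (_∸ codegree M) (trans (sym (rowSum-j-split M)) rowSum-j-in-G₋ᵢ))

  double-count : (W : Matrix N → ℕ) → (∀ c M → W (switch c M) ≡ W M) →
    ∑[ M ∈ Ms ] W M * (⟦ ∈G₋ⱼ? M ⟧ * onlyᵢ M) ≡ ∑[ M ∈ Ms ] W M * (⟦ ∈G₋ᵢ? M ⟧ * onlyⱼ M)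
  double-count W W-switch = begin
    ∑[ M ∈ Ms ] W M * (⟦ ∈G₋ⱼ? M ⟧ * onlyᵢ M)
      ≡⟨ ∑-cong Ms (λ M → expand M (∈G₋ⱼ? M) _) ⟩
    ∑[ M ∈ Ms ] (∑[ k ∈ allFin N ] pairs₋ⱼ M k)
      ≡⟨ ∑-comm pairs₋ⱼ Ms (allFin N) ⟩
    ∑[ k ∈ allFin N ] (∑[ M ∈ Ms ] pairs₋ⱼ M k)
      ≡⟨ ∑-cong (allFin N) (λ k → ∑-cong Ms (exchange k)) ⟩
    ∑[ k ∈ allFin N ] (∑[ M ∈ Ms ] pairs₋ᵢ (switch k M) k)
      ≡⟨ ∑-cong (allFin N) reindex ⟩
    ∑[ k ∈ allFin N ] (∑[ M ∈ Ms ] pairs₋ᵢ M k)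
      ≡⟨ ∑-comm pairs₋ᵢ Ms (allFin N) ⟨
    ∑[ M ∈ Ms ] (∑[ k ∈ allFin N ] pairs₋ᵢ M k)
      ≡⟨ ∑-cong Ms (λ M → expand M (∈G₋ᵢ? M) _) ⟨
    ∑[ M ∈ Ms ] W M * (⟦ ∈G₋ᵢ? M ⟧ * onlyⱼ M) ∎
    where
    open ≡-Reasoning
    pairs₋ⱼ pairs₋ᵢ : Matrix N → Fin N → ℕ
    pairs₋ⱼ M k = W M * (⟦ ∈G₋ⱼ? M ⟧ * 𝟙 (entry M i k ∧ not (entry M j k)))
    pairs₋ᵢ M k = W M * (⟦ ∈G₋ᵢ? M ⟧ * 𝟙 (not (entry M i k) ∧ entry M j k))

    expand : (M : Matrix N) (d : Dec P) (f : Fin N → ℕ) →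
      W M * (⟦ d ⟧ * ∑ (allFin N) f) ≡ ∑[ k ∈ allFin N ] W M * (⟦ d ⟧ * f k)
    expand M d f = sym (trans (∑-*ˡ (W M) _ (allFin N)) (cong (W M *_) (∑-*ˡ ⟦ d ⟧ f (allFin N))))

    reindex : ∀ k → ∑[ M ∈ Ms ] pairs₋ᵢ (switch k M) k ≡ ∑[ M ∈ Ms ] pairs₋ᵢ M k
    reindex k = ∑-reindex (allMats-enumerates N N) (switch k) (switch k)
      (switch-involutive k) (switch-involutive k) (λ M → pairs₋ᵢ M k)

    exchange : ∀ k M → W M * (⟦ ∈G₋ⱼ? M ⟧ * 𝟙 (entry M i k ∧ not (entry M j k)))
                     ≡ W (switch k M) * (⟦ ∈G₋ᵢ? (switch k M) ⟧
                         * 𝟙 (not (entry (switch k M) i k) ∧ entry (switch k M) j k))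
    exchange k M rewrite W-switch k M | entry-switch-on k M i | entry-switch-on k M j
                       | transpose-at-i {i = i} {j} | transpose-at-j {i = i} {j} =
      by-cases (entry M i k) (entry M j k) refl refl
      where
      both-zero : W M * (⟦ ∈G₋ⱼ? M ⟧ * 0) ≡ W M * (⟦ ∈G₋ᵢ? (switch k M) ⟧ * 0)
      both-zero = cong (W M *_) (trans (*-zeroʳ ⟦ ∈G₋ⱼ? M ⟧) (sym (*-zeroʳ ⟦ ∈G₋ᵢ? (switch k M) ⟧)))

      by-cases : ∀ x y → entry M i k ≡ x → entry M j k ≡ y →
        W M * (⟦ ∈G₋ⱼ? M ⟧ * 𝟙 (x ∧ not y)) ≡ W M * (⟦ ∈G₋ᵢ? (switch k M) ⟧ * 𝟙 (not y ∧ x))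
      by-cases true  false Mik Mjk =
        cong (λ h → W M * (⟦ h Bool.≟ true ⟧ * 1)) (hasMargins-switch {k} {M} Mik Mjk a b)
      by-cases true  true  _ _ = both-zero
      by-cases false true  _ _ = both-zero
      by-cases false false _ _ = both-zero

  stratum₋ⱼ stratum₋ᵢ : ℕ → ℕ
  stratum₋ⱼ t = ∑[ M ∈ Ms ] ⟦ codegree M ℕ.≟ t ⟧ * ⟦ ∈G₋ⱼ? M ⟧
  stratum₋ᵢ t = ∑[ M ∈ Ms ] ⟦ codegree M ℕ.≟ t ⟧ * ⟦ ∈G₋ᵢ? M ⟧

  stratum-balance : (t : ℕ) → stratum₋ⱼ t * (aᵢ ∸ t) ≡ stratum₋ᵢ t * (aⱼ ∸ t)
  stratum-balance t = begin
    stratum₋ⱼ t * (aᵢ ∸ t)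
      ≡⟨ ∑-*ʳ (aᵢ ∸ t) (λ M → ⟦ codegree M ℕ.≟ t ⟧ * ⟦ ∈G₋ⱼ? M ⟧) Ms ⟨
    ∑[ M ∈ Ms ] ⟦ codegree M ℕ.≟ t ⟧ * ⟦ ∈G₋ⱼ? M ⟧ * (aᵢ ∸ t)
      ≡⟨ ∑-cong Ms (λ M → ⟦⟧-guard₂ (codegree M ℕ.≟ t) (∈G₋ⱼ? M)
                            (λ cod≡t M∈G₋ⱼ → sym (trans (onlyᵢ-in-G₋ⱼ {M} M∈G₋ⱼ) (cong (aᵢ ∸_) cod≡t)))) ⟩
    ∑[ M ∈ Ms ] ⟦ codegree M ℕ.≟ t ⟧ * (⟦ ∈G₋ⱼ? M ⟧ * onlyᵢ M)
      ≡⟨ double-count (λ M → ⟦ codegree M ℕ.≟ t ⟧)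
                      (λ c M → cong (λ v → ⟦ v ℕ.≟ t ⟧) (codegree-switch c M)) ⟩
    ∑[ M ∈ Ms ] ⟦ codegree M ℕ.≟ t ⟧ * (⟦ ∈G₋ᵢ? M ⟧ * onlyⱼ M)
      ≡⟨ ∑-cong Ms (λ M → ⟦⟧-guard₂ (codegree M ℕ.≟ t) (∈G₋ᵢ? M)
                            (λ cod≡t M∈G₋ᵢ → sym (trans (onlyⱼ-in-G₋ᵢ {M} M∈G₋ᵢ) (cong (aⱼ ∸_) cod≡t)))) ⟨
    ∑[ M ∈ Ms ] ⟦ codegree M ℕ.≟ t ⟧ * ⟦ ∈G₋ᵢ? M ⟧ * (aⱼ ∸ t)
      ≡⟨ ∑-*ʳ (aⱼ ∸ t) (λ M → ⟦ codegree M ℕ.≟ t ⟧ * ⟦ ∈G₋ᵢ? M ⟧) Ms ⟩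
    stratum₋ᵢ t * (aⱼ ∸ t) ∎
    where open ≡-Reasoning

  switching-inequality : aⱼ ≤ aᵢ → aᵢ * numG N (minusUnit a j) b ≤ aⱼ * numG N (minusUnit a i) b
  switching-inequality aⱼ≤aᵢ = begin
    aᵢ * numG N (minusUnit a j) b
      ≡⟨ cong (aᵢ *_) (length-filter ∈G₋ⱼ? Ms) ⟩
    aᵢ * (∑[ M ∈ Ms ] ⟦ ∈G₋ⱼ? M ⟧)
      ≡⟨ *-comm aᵢ _ ⟩
    (∑[ M ∈ Ms ] ⟦ ∈G₋ⱼ? M ⟧) * aᵢ
      ≡⟨ cong (_* aᵢ) (∑-stratify aⱼ codegree Ms ∈G₋ⱼ? (λ M → codegree-in-G₋ⱼ {M})) ⟩
    (∑[ t ∈ allFin aⱼ ] stratum₋ⱼ (toℕ t)) * aᵢ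
      ≡⟨ ∑-*ʳ aᵢ (stratum₋ⱼ ∘ toℕ) (allFin aⱼ) ⟨
    ∑[ t ∈ allFin aⱼ ] stratum₋ⱼ (toℕ t) * aᵢ
      ≤⟨ ∑-mono (allFin aⱼ) per-stratum ⟩
    ∑[ t ∈ allFin aⱼ ] stratum₋ᵢ (toℕ t) * aⱼ
      ≡⟨ ∑-*ʳ aⱼ (stratum₋ᵢ ∘ toℕ) (allFin aⱼ) ⟩
    (∑[ t ∈ allFin aⱼ ] stratum₋ᵢ (toℕ t)) * aⱼ
      ≤⟨ *-monoˡ-≤ aⱼ (∑-strata-≤ aⱼ codegree Ms (λ M → ⟦ ∈G₋ᵢ? M ⟧)) ⟩
    (∑[ M ∈ Ms ] ⟦ ∈G₋ᵢ? M ⟧) * aⱼ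
      ≡⟨ *-comm _ aⱼ ⟩
    aⱼ * (∑[ M ∈ Ms ] ⟦ ∈G₋ᵢ? M ⟧)
      ≡⟨ cong (aⱼ *_) (length-filter ∈G₋ᵢ? Ms) ⟨
    aⱼ * numG N (minusUnit a i) b ∎
    where
    open ≤-Reasoning
    per-stratum : (t : Fin aⱼ) → stratum₋ⱼ (toℕ t) * aᵢ ≤ stratum₋ᵢ (toℕ t) * aⱼ
    per-stratum t = balance⇒≤ {stratum₋ⱼ (toℕ t)} {stratum₋ᵢ (toℕ t)}
      (stratum-balance (toℕ t)) (toℕ<n t) aⱼ≤aᵢ

corollary1 : (N : ℕ) (a b : Fin N → ℤ) → sumℤ a ≡ sumℤ b ℤ.+ 1ℤ →
    (i j : Fin N) → i ≢ j → a j ℤ.≤ a i → 0ℤ ℤ.< a j →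
    a i ℤ.* (+ numG N (minusUnit a j) b) ℤ.≤ a j ℤ.* (+ numG N (minusUnit a i) b)
corollary1 N a b _ i j i≢j aⱼ≤aᵢ 0<aⱼ = begin
  a i ℤ.* + nA                   ≡⟨ cong (ℤ._* + nA) a-i ⟩
  + ∣ a i ∣ ℤ.* + nA             ≡⟨ ℤP.pos-* ∣ a i ∣ nA ⟨
  + (∣ a i ∣ * nA)               ≤⟨ +≤+ (switching-inequality ∣aⱼ∣≤∣aᵢ∣) ⟩
  + (∣ a j ∣ * nB)               ≡⟨ ℤP.pos-* ∣ a j ∣ nB ⟩
  + ∣ a j ∣ ℤ.* + nB             ≡⟨ cong (ℤ._* + nB) a-j ⟨
  a j ℤ.* + nB                   ∎
  where
  open ℤP.≤-Reasoning
  nA nB : ℕ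
  nA = numG N (minusUnit a j) b
  nB = numG N (minusUnit a i) b
  0≤aⱼ : 0ℤ ℤ.≤ a j
  0≤aⱼ = ℤP.<⇒≤ 0<aⱼ
  a-i : a i ≡ + ∣ a i ∣
  a-i = sym (ℤP.0≤i⇒+∣i∣≡i (ℤP.≤-trans 0≤aⱼ aⱼ≤aᵢ))
  a-j : a j ≡ + ∣ a j ∣
  a-j = sym (ℤP.0≤i⇒+∣i∣≡i 0≤aⱼ)
  ∣aⱼ∣≤∣aᵢ∣ : ∣ a j ∣ ≤ ∣ a i ∣
  ∣aⱼ∣≤∣aᵢ∣ = ℤP.drop‿+≤+ (subst₂ ℤ._≤_ a-j a-i aⱼ≤aᵢ)
  open Counting a b i j i≢j ∣ a i ∣ ∣ a j ∣ a-i a-j
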